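{- Let $S\le T$ be subsets of $[n]$ in the type $C_n$ Gale order. Then the dual delta matroid $\Delta[S,T]^*$ equals the lattice path delta matroid $\Delta[[n]\setminus T,[n]\setminus S]$.
   Context: Type $C_n$ Gale order on subsets of $[n]$: for $A=\{a_1<\dots<a_j\}$, $B=\{b_1<\dots<b_k\}$, $A\le B$ iff $j\le k$ and $a_{j-i+1}\le b_{k-i+1}$ for all $i\in[j]$. $\Delta[S,T]$ is the delta matroid on $[n]$ with feasible sets all $R$ with $S\le R\le T$. The dual $\Delta^*$ of a delta matroid $\Delta$ on $[n]$ has feasible sets $\{[n]\setminus B: B \text{ feasible in }\Delta\}$. -}

module Defs where

open import Data.Nat using (ℕ; zero; suc; _≤_)
open import Data.Bool using (Bool; true; false)
open import Data.List using (List; []; _∷_; map; reverse)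
open import Data.Vec using ([]; _∷_)
open import Data.Fin.Subset using (Subset; ∁)
open import Data.Product using (Σ; _×_; ∃)
open import Data.Unit using (⊤)
open import Data.Empty using (⊥)
open import Relation.Binary.PropositionalEquality using (_≡_)
open import Function.Bundles using (_⇔_)

-- A subset of [n] = {1,…,n} is a 'Subset n' (= Vec Bool n); position i : Fin n
-- stands for the element toℕ i + 1.

elemsAsc : ∀ {n} → Subset n → List ℕ
elemsAsc []            = []
elemsAsc (true  ∷ v) = 1 ∷ map suc (elemsAsc v)
elemsAsc (false ∷ v) = map suc (elemsAsc v)

elemsDesc : ∀ {n} → Subset n → List ℕ
elemsDesc v = reverse (elemsAsc v)

DescLE : List ℕ → List ℕ → Set
DescLE []       _        = ⊤
DescLE (x ∷ xs) []       = ⊥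
DescLE (x ∷ xs) (y ∷ ys) = (x ≤ y) × DescLE xs ys

-- Type C_n Gale order: A ≤ B iff |A| ≤ |B| and a_{j-i+1} ≤ b_{k-i+1} for all i ∈ [j].
_≤C_ : ∀ {n} → Subset n → Subset n → Set
A ≤C B = DescLE (elemsDesc A) (elemsDesc B)

SetSystem : ℕ → Set₁
SetSystem n = Subset n → Set

Δ[_,_] : ∀ {n} → Subset n → Subset n → SetSystem n
Δ[ S , T ] R = (S ≤C R) × (R ≤C T)

dual : ∀ {n} → SetSystem n → SetSystem n
dual Δ R = ∃ λ B → Δ B × (R ≡ ∁ B)

_≋_ : ∀ {n} → SetSystem n → SetSystem n → Set
Δ₁ ≋ Δ₂ = ∀ R → Δ₁ R ⇔ Δ₂ R

module Submission where

-- Comparing elements from the largest down, A ≤ B in the type C Gale order holds exactly when,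
-- for every k, A has at most as many elements ≥ k as B.  Complementation replaces each of these suffix
-- counts c by (n − k + 1) − c, so it reverses the order; being an involution, it maps the
-- interval [S, T] onto the interval [[n] ∖ T, [n] ∖ S].

open import Defs
open import Data.Nat using (ℕ; suc; _≤_; _<_; z≤n; s≤s; s≤s⁻¹)
open import Data.Nat.Properties using (m≤n⇒m≤1+n; ∸-monoʳ-≤)
open import Data.Bool using (true; false)
open import Data.Bool.Properties using (not-involutive)
open import Data.List using ([]; _∷_; map; _∷ʳ_; length)
open import Data.List.Properties using (unfold-reverse; length-reverse; length-map; reverse-map)
open import Data.List.Relation.Unary.All using (All; []; _∷_; universal)
open import Data.List.Relation.Unary.All.Properties using (map⁺; ∷ʳ⁺)
open import Data.Vec using ([]; _∷_)
open import Data.Fin.Subset using (Subset; ∁; ∣_∣)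
open import Data.Fin.Subset.Properties using (∣∁p∣≡n∸∣p∣)
open import Data.Product using (_×_; _,_)
open import Data.Unit using (⊤; tt)
open import Data.Empty using (⊥)
open import Relation.Binary.PropositionalEquality
  using (_≡_; refl; sym; trans; cong; cong₂; subst; subst₂)
open import Function.Bundles using (_⇔_; mk⇔; Equivalence)

∁-involutive : ∀ {n} (p : Subset n) → ∁ (∁ p) ≡ p
∁-involutive []      = refl
∁-involutive (x ∷ p) = cong₂ _∷_ (not-involutive x) (∁-involutive p)

DescLE-map-suc : ∀ xs ys → DescLE (map suc xs) (map suc ys) ⇔ DescLE xs ys
DescLE-map-suc []       ys       = mk⇔ _ _
DescLE-map-suc (x ∷ xs) []       = mk⇔ (λ ()) (λ ())
DescLE-map-suc (x ∷ xs) (y ∷ ys) = mk⇔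
  (λ (x≤y , rest) → s≤s⁻¹ x≤y , Equivalence.to (DescLE-map-suc xs ys) rest)
  (λ (x≤y , rest) → s≤s x≤y , Equivalence.from (DescLE-map-suc xs ys) rest)

DescLE-∷ʳ-[] : ∀ {zs z} → DescLE (zs ∷ʳ z) [] → ⊥
DescLE-∷ʳ-[] {[]}    ()
DescLE-∷ʳ-[] {_ ∷ _} ()

DescLE-map-suc-∷ʳ-1 : ∀ xs ys → DescLE (map suc xs ∷ʳ 1) (map suc ys ∷ʳ 1) ⇔ DescLE xs ys
DescLE-map-suc-∷ʳ-1 []       []       = mk⇔ _ (λ _ → s≤s z≤n , tt)
DescLE-map-suc-∷ʳ-1 []       (y ∷ ys) = mk⇔ _ (λ _ → s≤s z≤n , tt)
DescLE-map-suc-∷ʳ-1 (x ∷ xs) []       = mk⇔ (λ (_ , rest) → DescLE-∷ʳ-[] rest) (λ ())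
DescLE-map-suc-∷ʳ-1 (x ∷ xs) (y ∷ ys) = mk⇔
  (λ (x≤y , rest) → s≤s⁻¹ x≤y , Equivalence.to (DescLE-map-suc-∷ʳ-1 xs ys) rest)
  (λ (x≤y , rest) → s≤s x≤y , Equivalence.from (DescLE-map-suc-∷ʳ-1 xs ys) rest)

DescLE-map-suc-∷ʳ-1ˡ : ∀ xs ys →
  DescLE (map suc xs ∷ʳ 1) (map suc ys) ⇔ (DescLE xs ys × length xs < length ys)
DescLE-map-suc-∷ʳ-1ˡ []       []       = mk⇔ (λ ()) (λ ())
DescLE-map-suc-∷ʳ-1ˡ []       (y ∷ ys) = mk⇔ (λ _ → tt , s≤s z≤n) (λ _ → s≤s z≤n , tt)
DescLE-map-suc-∷ʳ-1ˡ (x ∷ xs) []       = mk⇔ (λ ()) (λ ())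
DescLE-map-suc-∷ʳ-1ˡ (x ∷ xs) (y ∷ ys) = mk⇔
  (λ (x≤y , rest) → let (xs≤ys , shorter) = Equivalence.to (DescLE-map-suc-∷ʳ-1ˡ xs ys) rest
                    in (s≤s⁻¹ x≤y , xs≤ys) , s≤s shorter)
  (λ ((x≤y , xs≤ys) , shorter) →
    s≤s x≤y , Equivalence.from (DescLE-map-suc-∷ʳ-1ˡ xs ys) (xs≤ys , s≤s⁻¹ shorter))

DescLE-map-suc-∷ʳ-1ʳ : ∀ {xs} ys → All (1 ≤_) xs →
  DescLE (map suc xs) (map suc ys ∷ʳ 1) ⇔ DescLE xs ys
DescLE-map-suc-∷ʳ-1ʳ ys       []               = mk⇔ _ _
DescLE-map-suc-∷ʳ-1ʳ []       (s≤s _ ∷ _)      = mk⇔ (λ { (s≤s () , _) }) (λ ())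
DescLE-map-suc-∷ʳ-1ʳ (y ∷ ys) (_ ∷ positive) = mk⇔
  (λ (x≤y , rest) → s≤s⁻¹ x≤y , Equivalence.to (DescLE-map-suc-∷ʳ-1ʳ ys positive) rest)
  (λ (x≤y , rest) → s≤s x≤y , Equivalence.from (DescLE-map-suc-∷ʳ-1ʳ ys positive) rest)

elemsDesc-outside : ∀ {n} (v : Subset n) → elemsDesc (false ∷ v) ≡ map suc (elemsDesc v)
elemsDesc-outside v = sym (reverse-map suc (elemsAsc v))

elemsDesc-inside : ∀ {n} (v : Subset n) → elemsDesc (true ∷ v) ≡ map suc (elemsDesc v) ∷ʳ 1
elemsDesc-inside v =
  trans (unfold-reverse 1 (map suc (elemsAsc v))) (cong (_∷ʳ 1) (elemsDesc-outside v))

length-elemsAsc : ∀ {n} (v : Subset n) → length (elemsAsc v) ≡ ∣ v ∣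
length-elemsAsc []          = refl
length-elemsAsc (true ∷ v)  = cong suc (trans (length-map suc (elemsAsc v)) (length-elemsAsc v))
length-elemsAsc (false ∷ v) = trans (length-map suc (elemsAsc v)) (length-elemsAsc v)

length-elemsDesc : ∀ {n} (v : Subset n) → length (elemsDesc v) ≡ ∣ v ∣
length-elemsDesc v = trans (length-reverse (elemsAsc v)) (length-elemsAsc v)

map-suc-positive : ∀ xs → All (1 ≤_) (map suc xs)
map-suc-positive xs = map⁺ (universal (λ _ → s≤s z≤n) xs)

elemsDesc-positive : ∀ {n} (v : Subset n) → All (1 ≤_) (elemsDesc v)
elemsDesc-positive []          = []
elemsDesc-positive (true ∷ v)  rewrite elemsDesc-inside v  = ∷ʳ⁺ (map-suc-positive _) (s≤s z≤n)
elemsDesc-positive (false ∷ v) rewrite elemsDesc-outside v = map-suc-positive _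

∣p∣≤∣q∣⇒∣∁q∣≤∣∁p∣ : ∀ {n} (p q : Subset n) → ∣ p ∣ ≤ ∣ q ∣ → ∣ ∁ q ∣ ≤ ∣ ∁ p ∣
∣p∣≤∣q∣⇒∣∁q∣≤∣∁p∣ {n} p q p≤q =
  subst₂ _≤_ (sym (∣∁p∣≡n∸∣p∣ q)) (sym (∣∁p∣≡n∸∣p∣ p)) (∸-monoʳ-≤ n p≤q)

-- The clause at a ∷ A compares the numbers of elements ≥ k, where k is the element that
-- a stands for; hence this compares A and B on every final segment {k, …, n} of [n].
SuffixDominated : ∀ {n} → Subset n → Subset n → Set
SuffixDominated []      []      = ⊤
SuffixDominated (a ∷ A) (b ∷ B) = ∣ a ∷ A ∣ ≤ ∣ b ∷ B ∣ × SuffixDominated A B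

suffixDominated⇒∣∣≤ : ∀ {n} {A B : Subset n} → SuffixDominated A B → ∣ A ∣ ≤ ∣ B ∣
suffixDominated⇒∣∣≤ {A = []}    {[]}    _         = z≤n
suffixDominated⇒∣∣≤ {A = _ ∷ _} {_ ∷ _} (A≤B , _) = A≤B

≤C⇔suffixDominated : ∀ {n} (A B : Subset n) → A ≤C B ⇔ SuffixDominated A B
≤C⇔suffixDominated []          []          = mk⇔ _ _
≤C⇔suffixDominated (false ∷ A) (false ∷ B)
  rewrite elemsDesc-outside A | elemsDesc-outside B = mk⇔
    (λ A≤B → let dom = IH.to (L.to A≤B) in suffixDominated⇒∣∣≤ dom , dom)
    (λ (_ , dom) → L.from (IH.from dom))
  where module IH = Equivalence (≤C⇔suffixDominated A B)
        module L  = Equivalence (DescLE-map-suc (elemsDesc A) (elemsDesc B))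
≤C⇔suffixDominated (true ∷ A)  (true ∷ B)
  rewrite elemsDesc-inside A  | elemsDesc-inside B  = mk⇔
    (λ A≤B → let dom = IH.to (L.to A≤B) in s≤s (suffixDominated⇒∣∣≤ dom) , dom)
    (λ (_ , dom) → L.from (IH.from dom))
  where module IH = Equivalence (≤C⇔suffixDominated A B)
        module L  = Equivalence (DescLE-map-suc-∷ʳ-1 (elemsDesc A) (elemsDesc B))
≤C⇔suffixDominated (true ∷ A)  (false ∷ B)
  rewrite elemsDesc-inside A  | elemsDesc-outside B = mk⇔
    (λ A≤B → let (xs≤ys , shorter) = L.to A≤B in fewer shorter , IH.to xs≤ys)
    (λ (A<B , dom) → L.from (IH.from dom , longer A<B))
  where module IH = Equivalence (≤C⇔suffixDominated A B)
        module L  = Equivalence (DescLE-map-suc-∷ʳ-1ˡ (elemsDesc A) (elemsDesc B))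
        fewer : length (elemsDesc A) < length (elemsDesc B) → ∣ A ∣ < ∣ B ∣
        fewer  = subst₂ _<_ (length-elemsDesc A) (length-elemsDesc B)
        longer : ∣ A ∣ < ∣ B ∣ → length (elemsDesc A) < length (elemsDesc B)
        longer = subst₂ _<_ (sym (length-elemsDesc A)) (sym (length-elemsDesc B))
≤C⇔suffixDominated (false ∷ A) (true ∷ B)
  rewrite elemsDesc-outside A | elemsDesc-inside B  = mk⇔
    (λ A≤B → let dom = IH.to (L.to A≤B) in m≤n⇒m≤1+n (suffixDominated⇒∣∣≤ dom) , dom)
    (λ (_ , dom) → L.from (IH.from dom))
  where module IH = Equivalence (≤C⇔suffixDominated A B)
        module L  = Equivalence (DescLE-map-suc-∷ʳ-1ʳ (elemsDesc B) (elemsDesc-positive A))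

suffixDominated-∁ : ∀ {n} (A B : Subset n) → SuffixDominated A B → SuffixDominated (∁ B) (∁ A)
suffixDominated-∁ []      []      _           = tt
suffixDominated-∁ (a ∷ A) (b ∷ B) (A≤B , dom) =
  ∣p∣≤∣q∣⇒∣∁q∣≤∣∁p∣ (a ∷ A) (b ∷ B) A≤B , suffixDominated-∁ A B dom

∁-antitone : ∀ {n} (A B : Subset n) → A ≤C B → ∁ B ≤C ∁ A
∁-antitone A B A≤B = Equivalence.from (≤C⇔suffixDominated (∁ B) (∁ A))
  (suffixDominated-∁ A B (Equivalence.to (≤C⇔suffixDominated A B) A≤B))

proposition3p2 : (n : ℕ) (S T : Subset n) → S ≤C T →
    dual Δ[ S , T ] ≋ Δ[ ∁ T , ∁ S ]
proposition3p2 n S T _ R = mk⇔ to from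
  where
  to : dual Δ[ S , T ] R → Δ[ ∁ T , ∁ S ] R
  to (B , (S≤B , B≤T) , refl) = ∁-antitone B T B≤T , ∁-antitone S B S≤B
  from : Δ[ ∁ T , ∁ S ] R → dual Δ[ S , T ] R
  from (∁T≤R , R≤∁S) =
    ∁ R , (subst (_≤C ∁ R) (∁-involutive S) (∁-antitone R (∁ S) R≤∁S) ,
           subst (∁ R ≤C_) (∁-involutive T) (∁-antitone (∁ T) R ∁T≤R)) ,
    sym (∁-involutive R)
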